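{- Let $G$ be a quadrangulation of a surface $\Sigma$ and let $B_1,\dots,B_k$ be directed closed walks tracing the boundary cycles of $G$. If $\psi$ is a $3$-coloring of $G$, then $\sum_{i=1}^k\omega_\psi(B_i)\equiv p(G,B_1,\dots,B_k)\pmod 4$.
   Context: A surface is a compact connected $2$-manifold with possibly empty boundary. $G$ is a quadrangulation of $\Sigma$ if each face is an open disk bounded by a cycle of length $4$; the cuffs are traced by the boundary cycles. Let $\mathcal C$ consist of the facial and boundary cycles (each edge lies in exactly two of them). With the boundary cycles oriented as $B_1,\dots,B_k$ and each facial cycle oriented arbitrarily, let $D$ be the set of edges $uv$ oriented towards $v$ in both cycles of $\mathcal C$ containing them; $p(G,B_1,\dots,B_k)=2|D|\bmod 4$. For a $3$-coloring $\psi$ with colors $\{1,2,3\}$ and an edge $uv$, $\delta_\psi(u,v)=1$ if $\psi(v)-\psi(u)\in\{1,-2\}$ and $-1$ otherwise; for a directed closed walk $Q$, $\omega_\psi(Q)$ is one third of the sum of $\delta_\psi$ over the edges of $Q$. -}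

module Defs where

open import Data.Nat as ℕ using (ℕ; zero; suc; _≥_)
open import Data.Fin as Fin using (Fin; zero; suc)
open import Data.Fin.Properties using (_≟_)
open import Data.Bool using (Bool; true; false; if_then_else_)
open import Data.Bool.Properties renaming (_≟_ to _≟ᵇ_)
open import Data.List using (List; []; _∷_; _++_; concatMap; allFin; filter; length)
open import Data.Integer as ℤ using (ℤ; +_; -_; 0ℤ)
open import Data.Integer.DivMod using (_/ℕ_)
open import Data.Integer.Divisibility as ℤD using ()
open import Data.Product using (Σ; ∃; ∃-syntax; _×_; _,_; proj₁; proj₂)
open import Data.Sum using (_⊎_)
open import Function.Definitions using (Injective)
open import Relation.Binary.PropositionalEquality using (_≡_; _≢_)
open import Relation.Binary.Construct.Closure.ReflexiveTransitive using (Star)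
open import Relation.Nullary using (does)

record Graph : Set where
  field
    nV nE    : ℕ
    src tgt  : Fin nE → Fin nV
    loopless : ∀ e → src e ≢ tgt e
open Graph public

-- A dart = an edge with a direction (true = src→tgt, false = tgt→src).
Dart : Graph → Set
Dart G = Fin (nE G) × Bool

edgeOf : {G : Graph} → Dart G → Fin (nE G)
edgeOf = proj₁

tailD headD : {G : Graph} → Dart G → Fin (nV G)
tailD {G} (e , true)  = src G e
tailD {G} (e , false) = tgt G e
headD {G} (e , true)  = tgt G e
headD {G} (e , false) = src G e

nextF : ∀ {m} → Fin (suc m) → Fin (suc m)
nextF {m} i with Fin.toℕ i ℕ.<? m
... | Relation.Nullary.yes p = Fin.suc (Fin.fromℕ< p)
... | Relation.Nullary.no _  = zero

prevF : ∀ {m} → Fin (suc m) → Fin (suc m)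
prevF {m} zero    = Fin.fromℕ m
prevF {m} (suc i) = Fin.inject₁ i

record ClosedWalk (G : Graph) : Set where
  field
    lenP  : ℕ
    dart  : Fin (suc lenP) → Dart G
    glued : ∀ i → headD {G} (dart i) ≡ tailD {G} (dart (nextF i))
open ClosedWalk public

len : {G : Graph} → ClosedWalk G → ℕ
len W = suc (lenP W)

vtx : {G : Graph} (W : ClosedWalk G) → Fin (len W) → Fin (nV G)
vtx {G} W i = tailD {G} (dart W i)

IsCycle : {G : Graph} → ClosedWalk G → Set
IsCycle {G} W = Injective _≡_ _≡_ (vtx W)
              × Injective _≡_ _≡_ (λ i → edgeOf {G} (dart W i))

-- Quadrangulations of a surface with boundary.
-- Faces: f directed 4-cycles (arbitrary orientation); boundary cycles
-- B_1..B_k (given orientation).  The set 𝒞 is indexed by Fin f ⊎ Fin k.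

record QuadData (G : Graph) (k : ℕ) : Set where
  field
    f     : ℕ
    face  : Fin f → ClosedWalk G
    bdry  : Fin k → ClosedWalk G
open QuadData public

module _ {G : Graph} {k : ℕ} (Q : QuadData G k) where

  CIdx : Set
  CIdx = Fin (f Q) ⊎ Fin k

  cyc : CIdx → ClosedWalk G
  cyc (Data.Sum.inj₁ i) = face Q i
  cyc (Data.Sum.inj₂ j) = bdry Q j

  allC : List CIdx
  allC = Data.List.map Data.Sum.inj₁ (allFin (f Q)) ++ Data.List.map Data.Sum.inj₂ (allFin k)

  OnC : Fin (nE G) → CIdx → Set
  OnC e c = ∃[ i ] edgeOf {G} (dart (cyc c) i) ≡ e

  Corner : Set
  Corner = Σ CIdx (λ c → Fin (len (cyc c)))

  cornerV : Corner → Fin (nV G)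
  cornerV (c , i) = vtx (cyc c) i

  inE outE : Corner → Fin (nE G)
  inE  (c , i) = edgeOf {G} (dart (cyc c) (prevF i))
  outE (c , i) = edgeOf {G} (dart (cyc c) i)

  CornerAdj : Corner → Corner → Set
  CornerAdj a b = (cornerV a ≡ cornerV b) ×
    ((inE a ≡ inE b) ⊎ (inE a ≡ outE b) ⊎ (outE a ≡ inE b) ⊎ (outE a ≡ outE b))

  GAdj : Fin (nV G) → Fin (nV G) → Set
  GAdj u v = ∃[ e ] ((src G e ≡ u × tgt G e ≡ v) ⊎ (src G e ≡ v × tgt G e ≡ u))

  record IsQuadrangulation : Set where
    field
      faceCycle   : ∀ i → IsCycle (face Q i) × len (face Q i) ≡ 4
      bdryCycle   : ∀ j → IsCycle (bdry Q j)
      edgeTwice   : ∀ e → ∃[ c₁ ] ∃[ c₂ ] (c₁ ≢ c₂ × OnC e c₁ × OnC e c₂ ×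
                      (∀ c → OnC e c → c ≡ c₁ ⊎ c ≡ c₂))
      -- manifold condition at vertices: every vertex has a corner, and the
      -- corners around each vertex are connected via shared edges
      -- (so, capping the cuffs, the link of each vertex is one cycle) …
      hasCorner   : ∀ v → ∃[ a ] cornerV a ≡ v
      linkConn    : ∀ a b → cornerV a ≡ cornerV b → Star CornerAdj a b
      -- … and each vertex lies on at most one cuff (cuffs are disjoint circles)
      cuffsDisj   : ∀ j₁ j₂ i₁ i₂ → vtx (bdry Q j₁) i₁ ≡ vtx (bdry Q j₂) i₂ → j₁ ≡ j₂
      connected   : ∀ u v → Star GAdj u v

  dirs : Fin (nE G) → List Bool
  dirs e = concatMap (λ c → concatMap (λ i → let d = dart (cyc c) i in
             if does (proj₁ d ≟ e) then proj₂ d ∷ [] else [])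
             (allFin (len (cyc c)))) allC

  -- e ∈ D : both 𝒞-cycles containing e traverse it towards the same end
  inD : Fin (nE G) → Bool
  inD e with dirs e
  ... | b₁ ∷ b₂ ∷ [] = does (b₁ ≟ᵇ b₂)
  ... | _            = false

  sizeD : ℕ
  sizeD = length (filter (λ e → inD e ≟ᵇ true) (allFin (nE G)))

  parity : ℕ
  parity = (2 ℕ.* sizeD) ℕ.% 4

-- 3-colourings (colours Fin 3 = {0,1,2}, standing for {1,2,3})

IsColoring : (G : Graph) → (Fin (nV G) → Fin 3) → Set
IsColoring G ψ = ∀ e → ψ (src G e) ≢ ψ (tgt G e)

δc : Fin 3 → Fin 3 → ℤ
δc zero             (suc zero)       = + 1
δc (suc zero)       (suc (suc zero)) = + 1
δc (suc (suc zero)) zero             = + 1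
δc _                _                = - (+ 1)

sumℤ : List ℤ → ℤ
sumℤ = Data.List.foldr ℤ._+_ 0ℤ

δsum : {G : Graph} → (Fin (nV G) → Fin 3) → ClosedWalk G → ℤ
δsum {G} ψ W = sumℤ (Data.List.map (λ i → δc (ψ (tailD {G} (dart W i))) (ψ (headD {G} (dart W i))))
                                  (allFin (len W)))

-- ω_ψ(Q) = (1/3) Σ δ_ψ  (the sum is always divisible by 3 for a closed walk)
ω : {G : Graph} → (Fin (nV G) → Fin 3) → ClosedWalk G → ℤ
ω ψ W = δsum ψ W /ℕ 3

_≡_[mod_] : ℤ → ℤ → ℕ → Set
a ≡ b [mod n ] = (+ n) ℤD.∣ (a ℤ.- b)

{-# OPTIONS --safe #-}

-- For a proper 3-colouring, δ(u,v) ≡ ψ(v) − ψ(u) (mod 3), so the δ-sum of every closed walk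
-- telescopes to a multiple of 3; on a 4-cycle it is a sum of four ±1's and hence 0.  Summing δ
-- over all cycles of 𝒞 therefore gives 3·Σᵢ ω(Bᵢ).  Regrouped by edges, the same sum sees every
-- edge e exactly twice, with terms ±δ(e) = ±1: they add up to ±2 ≡ 2 (mod 4) when both
-- traversals agree (e ∈ D) and to 0 otherwise.  Hence 3·Σᵢ ω(Bᵢ) ≡ 2|D| (mod 4).

module Submission where

open import Defs
open import Data.Nat using (ℕ)
open import Data.Fin using (Fin)
open import Data.List using (map; allFin)
open import Data.Integer using (+_)

open import Data.Nat as ℕ using (zero; suc)
import Data.Nat.Properties as ℕ
open import Data.Nat.DivMod using (m<n⇒m%n≡m)
import Data.Nat.Divisibility as ℕ
open import Data.Fin using (zero; suc; toℕ; inject₁; fromℕ)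
open import Data.Fin.Properties using (_≟_; any?; fromℕ<-cong; toℕ-inject₁; toℕ<n; fromℕ<-toℕ; toℕ-fromℕ)
open import Data.Bool using (Bool; true; false; if_then_else_)
open import Data.Bool.Properties using () renaming (_≟_ to _≟ᵇ_)
open import Data.List using (List; []; _∷_; _++_; concatMap; length; filter)
open import Data.List.Properties using (map-cong; map-∘; map-tabulate)
open import Data.Integer using (ℤ; ∣_∣; 0ℤ; 1ℤ; -1ℤ; -_; _+_; _-_; _*_; _/ℕ_; _%ℕ_)
open import Data.Integer.Properties using (+-identityˡ; +-identityʳ; +-assoc; +-comm; +-inverseʳ; *-distribʳ-+; neg-distrib-+; pos-*; +-injective)
open import Data.Integer.DivMod using (a≡a%ℕn+[a/ℕn]*n; n%ℕd<d)
open import Data.Integer.Divisibility.Signed using (_∣_; divides; ∣⇒∣ᵤ; ∣-refl; ∣m∣n⇒∣m+n; ∣m∣n⇒∣m-n; ∣m+n∣n⇒∣m; ∣n⇒∣m*n)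
open import Data.Integer.Tactic.RingSolver using (solve-∀)
open import Data.Product using (_,_; proj₁; proj₂)
open import Data.Sum using (_⊎_; inj₁; inj₂)
open import Data.Sum.Properties using (≡-dec)
open import Data.Empty using (⊥-elim)
open import Function using (_∘_; id; const)
open import Function.Definitions using (Injective)
open import Relation.Binary.PropositionalEquality
open import Relation.Binary.Definitions using (DecidableEquality)
open import Relation.Nullary using (Dec; does; yes; no; ¬_)
open import Relation.Nullary.Decidable using (dec-true; dec-false)

-- Sums of integers over lists

module _ {A : Set} where

  ∑ : (A → ℤ) → List A → ℤ
  ∑ g xs = sumℤ (map g xs)

  syntax ∑ (λ x → e) xs = ∑[ x ∈ xs ] e

  ∑-cong : ∀ {g h : A → ℤ} → (∀ x → g x ≡ h x) → ∀ xs → ∑ g xs ≡ ∑ h xs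
  ∑-cong g≗h xs = cong sumℤ (map-cong g≗h xs)

  ∑-zero : ∀ xs → ∑[ _ ∈ xs ] 0ℤ ≡ 0ℤ
  ∑-zero []       = refl
  ∑-zero (x ∷ xs) = trans (+-identityˡ _) (∑-zero xs)

  ∑-++ : ∀ (g : A → ℤ) xs ys → ∑ g (xs ++ ys) ≡ ∑ g xs + ∑ g ys
  ∑-++ g []       ys = sym (+-identityˡ _)
  ∑-++ g (x ∷ xs) ys = trans (cong (_+_ (g x)) (∑-++ g xs ys)) (sym (+-assoc (g x) _ _))

  ∑-distrib-+ : ∀ (g h : A → ℤ) xs → ∑[ x ∈ xs ] (g x + h x) ≡ ∑ g xs + ∑ h xs
  ∑-distrib-+ g h []       = refl
  ∑-distrib-+ g h (x ∷ xs) = trans (cong (_+_ (g x + h x)) (∑-distrib-+ g h xs)) (interchange (g x) (h x) _ _)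
    where
    interchange : ∀ a b c d → a + b + (c + d) ≡ a + c + (b + d)
    interchange = solve-∀

  ∑-distrib-- : ∀ (g h : A → ℤ) xs → ∑[ x ∈ xs ] (g x - h x) ≡ ∑ g xs - ∑ h xs
  ∑-distrib-- g h xs = trans (∑-distrib-+ g (-_ ∘ h) xs) (cong (_+_ (∑ g xs)) (∑-neg xs))
    where
    ∑-neg : ∀ xs → ∑[ x ∈ xs ] (- h x) ≡ - ∑ h xs
    ∑-neg []       = refl
    ∑-neg (x ∷ xs) = trans (cong (_+_ (- h x)) (∑-neg xs)) (sym (neg-distrib-+ (h x) _))

  ∑-distribʳ-* : ∀ (g : A → ℤ) c xs → ∑[ x ∈ xs ] (g x * c) ≡ ∑ g xs * c
  ∑-distribʳ-* g c []       = refl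
  ∑-distribʳ-* g c (x ∷ xs) = trans (cong (_+_ (g x * c)) (∑-distribʳ-* g c xs)) (sym (*-distribʳ-+ c (g x) _))

  ∑-∣ : ∀ {m} (g : A → ℤ) xs → (∀ x → m ∣ g x) → m ∣ ∑ g xs
  ∑-∣ g []       m∣g = divides 0ℤ refl
  ∑-∣ g (x ∷ xs) m∣g = ∣m∣n⇒∣m+n (m∣g x) (∑-∣ g xs m∣g)

  ∑-if-singleton : ∀ (g : A → ℤ) b x → ∑ g (if b then x ∷ [] else []) ≡ (if b then g x else 0ℤ)
  ∑-if-singleton g true  x = +-identityʳ (g x)
  ∑-if-singleton g false x = refl

  +length≡∑1 : ∀ (xs : List A) → + length xs ≡ ∑[ _ ∈ xs ] 1ℤ
  +length≡∑1 []       = refl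
  +length≡∑1 (x ∷ xs) = cong (_+_ 1ℤ) (+length≡∑1 xs)

  ∑-if-count : ∀ (P : A → Bool) m xs →
    ∑[ x ∈ xs ] (if P x then + m else 0ℤ) ≡ + (m ℕ.* length (filter (λ x → P x ≟ᵇ true) xs))
  ∑-if-count P m []       = cong +_ (sym (ℕ.*-zeroʳ m))
  ∑-if-count P m (x ∷ xs) with P x
  ... | true  = trans (cong (_+_ (+ m)) (∑-if-count P m xs)) (cong +_ (sym (ℕ.*-suc m _)))
  ... | false = trans (+-identityˡ _) (∑-if-count P m xs)

module _ {A B : Set} where

  ∑-map : ∀ (g : B → ℤ) (h : A → B) xs → ∑ g (map h xs) ≡ ∑ (g ∘ h) xs
  ∑-map g h xs = cong sumℤ (sym (map-∘ xs))

  ∑-concatMap : ∀ (g : B → ℤ) (F : A → List B) xs → ∑ g (concatMap F xs) ≡ ∑[ x ∈ xs ] ∑ g (F x)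
  ∑-concatMap g F []       = refl
  ∑-concatMap g F (x ∷ xs) = trans (∑-++ g (F x) (concatMap F xs)) (cong (_+_ (∑ g (F x))) (∑-concatMap g F xs))

  ∑-comm : ∀ (g : A → B → ℤ) xs ys → ∑[ x ∈ xs ] ∑[ y ∈ ys ] g x y ≡ ∑[ y ∈ ys ] ∑[ x ∈ xs ] g x y
  ∑-comm g []       ys = sym (∑-zero ys)
  ∑-comm g (x ∷ xs) ys = trans (cong (_+_ (∑ (g x) ys)) (∑-comm g xs ys)) (sym (∑-distrib-+ (g x) _ ys))

∑-allFin-suc : ∀ n (g : Fin (suc n) → ℤ) → ∑ g (allFin (suc n)) ≡ g zero + ∑ (g ∘ suc) (allFin n)
∑-allFin-suc n g = cong (λ s → g zero + sumℤ s) (trans (map-tabulate suc g) (sym (map-tabulate id (g ∘ suc))))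

∑-allFin-init-last : ∀ n (g : Fin (suc n) → ℤ) → ∑ g (allFin (suc n)) ≡ ∑ (g ∘ inject₁) (allFin n) + g (fromℕ n)
∑-allFin-init-last zero    g = trans (+-identityʳ (g zero)) (sym (+-identityˡ (g zero)))
∑-allFin-init-last (suc n) g = begin
  ∑ g (allFin (suc (suc n)))                                       ≡⟨ ∑-allFin-suc (suc n) g ⟩
  g zero + ∑ (g ∘ suc) (allFin (suc n))                            ≡⟨ cong (_+_ (g zero)) (∑-allFin-init-last n (g ∘ suc)) ⟩
  g zero + (∑ (g ∘ suc ∘ inject₁) (allFin n) + g (fromℕ (suc n)))  ≡⟨ sym (+-assoc (g zero) _ _) ⟩
  g zero + ∑ (g ∘ suc ∘ inject₁) (allFin n) + g (fromℕ (suc n))    ≡⟨ cong (_+ g (fromℕ (suc n))) (sym (∑-allFin-suc n (g ∘ inject₁))) ⟩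
  ∑ (g ∘ inject₁) (allFin (suc n)) + g (fromℕ (suc n))             ∎
  where open ≡-Reasoning

∑-allFin-select : ∀ n (a : Fin n) (g : Fin n → ℤ) → ∑[ e ∈ allFin n ] (if does (a ≟ e) then g e else 0ℤ) ≡ g a
∑-allFin-select (suc n) zero    g = begin
  ∑[ e ∈ allFin (suc n) ] (if does (zero ≟ e) then g e else 0ℤ)
    ≡⟨ ∑-allFin-suc n (λ e → if does (zero ≟ e) then g e else 0ℤ) ⟩
  g zero + ∑[ _ ∈ allFin n ] 0ℤ
    ≡⟨ cong (_+_ (g zero)) (∑-zero (allFin n)) ⟩
  g zero + 0ℤ
    ≡⟨ +-identityʳ (g zero) ⟩
  g zero
    ∎
  where open ≡-Reasoning
∑-allFin-select (suc n) (suc a) g =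
  trans (∑-allFin-suc n (λ e → if does (suc a ≟ e) then g e else 0ℤ))
        (trans (+-identityˡ _) (∑-allFin-select n a (g ∘ suc)))

𝟙 : {P : Set} → Dec P → ℤ
𝟙 P? = if does P? then 1ℤ else 0ℤ

𝟙-yes : ∀ {P : Set} (P? : Dec P) → P → 𝟙 P? ≡ 1ℤ
𝟙-yes P? p = cong (λ b → if b then 1ℤ else 0ℤ) (dec-true P? p)

𝟙-no : ∀ {P : Set} (P? : Dec P) → ¬ P → 𝟙 P? ≡ 0ℤ
𝟙-no P? ¬p = cong (λ b → if b then 1ℤ else 0ℤ) (dec-false P? ¬p)

module _ {n m} (g : Fin n → Fin m) where

  ∑-allFin-fibre-injective : Injective _≡_ _≡_ g → ∀ {e} i₀ → g i₀ ≡ e → ∑[ i ∈ allFin n ] 𝟙 (g i ≟ e) ≡ 1ℤ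
  ∑-allFin-fibre-injective g-inj {e} i₀ gi₀≡e =
    trans (∑-cong fibre≡singleton (allFin n)) (∑-allFin-select n i₀ (const 1ℤ))
    where
    fibre≡singleton : ∀ i → 𝟙 (g i ≟ e) ≡ 𝟙 (i₀ ≟ i)
    fibre≡singleton i with g i ≟ e | i₀ ≟ i
    ... | yes _      | yes _     = refl
    ... | no  _      | no  _     = refl
    ... | yes gi≡e   | no  i₀≢i  = ⊥-elim (i₀≢i (g-inj (trans gi₀≡e (sym gi≡e))))
    ... | no  gi≢e   | yes refl  = ⊥-elim (gi≢e gi₀≡e)

  ∑-allFin-fibre-empty : ∀ {e} → (∀ i → g i ≢ e) → ∑[ i ∈ allFin n ] 𝟙 (g i ≟ e) ≡ 0ℤ
  ∑-allFin-fibre-empty g≢e = trans (∑-cong (λ i → 𝟙-no (g i ≟ _) (g≢e i)) (allFin n)) (∑-zero (allFin n))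

nextF-inject₁ : ∀ {n} (i : Fin n) → nextF (inject₁ i) ≡ suc i
nextF-inject₁ {n} i with toℕ (inject₁ i) ℕ.<? n
... | yes i<n = cong suc (trans (fromℕ<-cong _ _ (toℕ-inject₁ i) i<n (toℕ<n i)) (fromℕ<-toℕ i (toℕ<n i)))
... | no  i≮n = ⊥-elim (i≮n (subst (ℕ._< n) (sym (toℕ-inject₁ i)) (toℕ<n i)))

nextF-fromℕ : ∀ n → nextF (fromℕ n) ≡ zero
nextF-fromℕ n with toℕ (fromℕ n) ℕ.<? n
... | yes n<n = ⊥-elim (ℕ.<-irrefl (toℕ-fromℕ n) n<n)
... | no  _   = refl

∑-allFin-rotate : ∀ n (g : Fin (suc n) → ℤ) → ∑ (g ∘ nextF) (allFin (suc n)) ≡ ∑ g (allFin (suc n))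
∑-allFin-rotate n g = begin
  ∑ (g ∘ nextF) (allFin (suc n))                                   ≡⟨ ∑-allFin-init-last n (g ∘ nextF) ⟩
  ∑ (g ∘ nextF ∘ inject₁) (allFin n) + g (nextF (fromℕ n))
                                             ≡⟨ cong₂ _+_ (∑-cong (cong g ∘ nextF-inject₁) (allFin n)) (cong g (nextF-fromℕ n)) ⟩
  ∑ (g ∘ suc) (allFin n) + g zero                                  ≡⟨ +-comm _ (g zero) ⟩
  g zero + ∑ (g ∘ suc) (allFin n)                                  ≡⟨ sym (∑-allFin-suc n g) ⟩
  ∑ g (allFin (suc n))                                             ∎
  where open ≡-Reasoning

∑-allFin-telescope : ∀ n (z : Fin (suc n) → ℤ) → ∑[ i ∈ allFin (suc n) ] (z (nextF i) - z i) ≡ 0ℤ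
∑-allFin-telescope n z = begin
  ∑[ i ∈ allFin (suc n) ] (z (nextF i) - z i)                ≡⟨ ∑-distrib-- (z ∘ nextF) z (allFin (suc n)) ⟩
  ∑ (z ∘ nextF) (allFin (suc n)) - ∑ z (allFin (suc n))      ≡⟨ cong (_- ∑ z (allFin (suc n))) (∑-allFin-rotate n z) ⟩
  ∑ z (allFin (suc n)) - ∑ z (allFin (suc n))                ≡⟨ +-inverseʳ (∑ z (allFin (suc n))) ⟩
  0ℤ                                                         ∎
  where open ≡-Reasoning

-- Integer arithmetic

[i/ℕn]*n≡i : ∀ i n .{{_ : ℕ.NonZero n}} → + n ∣ i → (i /ℕ n) * + n ≡ i
[i/ℕn]*n≡i i n n∣i = begin
  (i /ℕ n) * + n                ≡⟨ +-identityˡ _ ⟨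
  + 0 + (i /ℕ n) * + n          ≡⟨ cong (λ r → + r + (i /ℕ n) * + n) remainder≡0 ⟨
  + (i %ℕ n) + (i /ℕ n) * + n   ≡⟨ a≡a%ℕn+[a/ℕn]*n i n ⟨
  i                             ∎
  where
  n∣remainder : + n ∣ + (i %ℕ n)
  n∣remainder = ∣m+n∣n⇒∣m (subst (+ n ∣_) (a≡a%ℕn+[a/ℕn]*n i n) n∣i) (∣n⇒∣m*n (i /ℕ n) ∣-refl)
  remainder≡0 : i %ℕ n ≡ 0
  remainder≡0 = trans (sym (m<n⇒m%n≡m (n%ℕd<d i n))) (ℕ.n∣m⇒m%n≡0 _ n (∣⇒∣ᵤ n∣remainder))
  open ≡-Reasoning

n∣i-i%ℕn : ∀ i n .{{_ : ℕ.NonZero n}} → + n ∣ i - + (i %ℕ n)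
n∣i-i%ℕn i n = divides (i /ℕ n) (trans (cong (_- + (i %ℕ n)) (a≡a%ℕn+[a/ℕn]*n i n)) (cancel (+ (i %ℕ n)) _))
  where
  cancel : ∀ r x → r + x - r ≡ x
  cancel = solve-∀

IsUnit : ℤ → Set
IsUnit x = x ≡ 1ℤ ⊎ x ≡ -1ℤ

3∤ : ∀ {s} → ∣ s ∣ ℕ.% 3 ≢ 0 → ¬ (+ 3 ∣ s)
3∤ s%3≢0 3∣s = s%3≢0 (ℕ.n∣m⇒m%n≡0 _ 3 (∣⇒∣ᵤ 3∣s))

units-sum4-divisible-by-3 : ∀ {a b c d} → IsUnit a → IsUnit b → IsUnit c → IsUnit d →
  + 3 ∣ a + (b + (c + (d + 0ℤ))) → a + (b + (c + (d + 0ℤ))) ≡ 0ℤ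
units-sum4-divisible-by-3 (inj₁ refl) (inj₁ refl) (inj₁ refl) (inj₁ refl) 3∣s = ⊥-elim (3∤ (λ ()) 3∣s)
units-sum4-divisible-by-3 (inj₁ refl) (inj₁ refl) (inj₁ refl) (inj₂ refl) 3∣s = ⊥-elim (3∤ (λ ()) 3∣s)
units-sum4-divisible-by-3 (inj₁ refl) (inj₁ refl) (inj₂ refl) (inj₁ refl) 3∣s = ⊥-elim (3∤ (λ ()) 3∣s)
units-sum4-divisible-by-3 (inj₁ refl) (inj₁ refl) (inj₂ refl) (inj₂ refl) 3∣s = refl
units-sum4-divisible-by-3 (inj₁ refl) (inj₂ refl) (inj₁ refl) (inj₁ refl) 3∣s = ⊥-elim (3∤ (λ ()) 3∣s)
units-sum4-divisible-by-3 (inj₁ refl) (inj₂ refl) (inj₁ refl) (inj₂ refl) 3∣s = refl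
units-sum4-divisible-by-3 (inj₁ refl) (inj₂ refl) (inj₂ refl) (inj₁ refl) 3∣s = refl
units-sum4-divisible-by-3 (inj₁ refl) (inj₂ refl) (inj₂ refl) (inj₂ refl) 3∣s = ⊥-elim (3∤ (λ ()) 3∣s)
units-sum4-divisible-by-3 (inj₂ refl) (inj₁ refl) (inj₁ refl) (inj₁ refl) 3∣s = ⊥-elim (3∤ (λ ()) 3∣s)
units-sum4-divisible-by-3 (inj₂ refl) (inj₁ refl) (inj₁ refl) (inj₂ refl) 3∣s = refl
units-sum4-divisible-by-3 (inj₂ refl) (inj₁ refl) (inj₂ refl) (inj₁ refl) 3∣s = refl
units-sum4-divisible-by-3 (inj₂ refl) (inj₁ refl) (inj₂ refl) (inj₂ refl) 3∣s = ⊥-elim (3∤ (λ ()) 3∣s)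
units-sum4-divisible-by-3 (inj₂ refl) (inj₂ refl) (inj₁ refl) (inj₁ refl) 3∣s = refl
units-sum4-divisible-by-3 (inj₂ refl) (inj₂ refl) (inj₁ refl) (inj₂ refl) 3∣s = ⊥-elim (3∤ (λ ()) 3∣s)
units-sum4-divisible-by-3 (inj₂ refl) (inj₂ refl) (inj₂ refl) (inj₁ refl) 3∣s = ⊥-elim (3∤ (λ ()) 3∣s)
units-sum4-divisible-by-3 (inj₂ refl) (inj₂ refl) (inj₂ refl) (inj₂ refl) 3∣s = ⊥-elim (3∤ (λ ()) 3∣s)

oriented : ℤ → Bool → ℤ
oriented x true  = x
oriented x false = - x

unit-twice-oriented-mod-4 : ∀ {x} → IsUnit x → ∀ b₁ b₂ →
  + 4 ∣ oriented x b₁ + (oriented x b₂ + 0ℤ) - (if does (b₁ ≟ᵇ b₂) then + 2 else 0ℤ)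
unit-twice-oriented-mod-4 (inj₁ refl) true  true  = divides 0ℤ refl
unit-twice-oriented-mod-4 (inj₁ refl) true  false = divides 0ℤ refl
unit-twice-oriented-mod-4 (inj₁ refl) false true  = divides 0ℤ refl
unit-twice-oriented-mod-4 (inj₁ refl) false false = divides -1ℤ refl
unit-twice-oriented-mod-4 (inj₂ refl) true  true  = divides -1ℤ refl
unit-twice-oriented-mod-4 (inj₂ refl) true  false = divides 0ℤ refl
unit-twice-oriented-mod-4 (inj₂ refl) false true  = divides 0ℤ refl
unit-twice-oriented-mod-4 (inj₂ refl) false false = divides 0ℤ refl

-- 3 ≡ -1 and 2s ≡ -2s modulo 4.
w*3≡2s⇒w≡2s%4 : ∀ w s → + 4 ∣ w * + 3 - + (2 ℕ.* s) → + 4 ∣ w - + ((2 ℕ.* s) ℕ.% 4)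
w*3≡2s⇒w≡2s%4 w s 4∣3w-2s =
  subst (+ 4 ∣_) (rearrange w t (+ (t %ℕ 4)))
    (∣m∣n⇒∣m+n (∣m∣n⇒∣m-n (∣m∣n⇒∣m-n (∣n⇒∣m*n w ∣-refl) 4∣3w-2s) 4∣t+t) (n∣i-i%ℕn t 4))
  where
  t : ℤ
  t = + (2 ℕ.* s)
  rearrange : ∀ w t r → w * + 4 - (w * + 3 - t) - (t + t) + (t - r) ≡ w - r
  rearrange = solve-∀
  double : ∀ x → + 2 * x + + 2 * x ≡ x * + 4
  double = solve-∀
  4∣t+t : + 4 ∣ t + t
  4∣t+t = divides (+ s) (trans (cong₂ _+_ (pos-* 2 s) (pos-* 2 s)) (double (+ s)))

-- δ of a proper 3-colouring

δc-unit : ∀ a b → IsUnit (δc a b)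
δc-unit zero             zero             = inj₂ refl
δc-unit zero             (suc zero)       = inj₁ refl
δc-unit zero             (suc (suc zero)) = inj₂ refl
δc-unit (suc zero)       zero             = inj₂ refl
δc-unit (suc zero)       (suc zero)       = inj₂ refl
δc-unit (suc zero)       (suc (suc zero)) = inj₁ refl
δc-unit (suc (suc zero)) zero             = inj₁ refl
δc-unit (suc (suc zero)) (suc zero)       = inj₂ refl
δc-unit (suc (suc zero)) (suc (suc zero)) = inj₂ refl

δc-antisym : ∀ a b → a ≢ b → δc b a ≡ - δc a b
δc-antisym zero             zero             a≢b = ⊥-elim (a≢b refl)
δc-antisym zero             (suc zero)       _   = refl
δc-antisym zero             (suc (suc zero)) _   = refl
δc-antisym (suc zero)       zero             _   = refl
δc-antisym (suc zero)       (suc zero)       a≢b = ⊥-elim (a≢b refl)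
δc-antisym (suc zero)       (suc (suc zero)) _   = refl
δc-antisym (suc (suc zero)) zero             _   = refl
δc-antisym (suc (suc zero)) (suc zero)       _   = refl
δc-antisym (suc (suc zero)) (suc (suc zero)) a≢b = ⊥-elim (a≢b refl)

δc≡difference-mod-3 : ∀ a b → a ≢ b → + 3 ∣ δc a b - (+ toℕ b - + toℕ a)
δc≡difference-mod-3 zero             zero             a≢b = ⊥-elim (a≢b refl)
δc≡difference-mod-3 zero             (suc zero)       _   = divides 0ℤ refl
δc≡difference-mod-3 zero             (suc (suc zero)) _   = divides -1ℤ refl
δc≡difference-mod-3 (suc zero)       zero             _   = divides 0ℤ refl
δc≡difference-mod-3 (suc zero)       (suc zero)       a≢b = ⊥-elim (a≢b refl)
δc≡difference-mod-3 (suc zero)       (suc (suc zero)) _   = divides 0ℤ refl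
δc≡difference-mod-3 (suc (suc zero)) zero             _   = divides 1ℤ refl
δc≡difference-mod-3 (suc (suc zero)) (suc zero)       _   = divides 0ℤ refl
δc≡difference-mod-3 (suc (suc zero)) (suc (suc zero)) a≢b = ⊥-elim (a≢b refl)

module Colouring (G : Graph) (ψ : Fin (nV G) → Fin 3) where

  δ : Dart G → ℤ
  δ d = δc (ψ (tailD {G} d)) (ψ (headD {G} d))

  δ-unit : ∀ d → IsUnit (δ d)
  δ-unit d = δc-unit (ψ (tailD {G} d)) (ψ (headD {G} d))

  module _ (proper : IsColoring G ψ) where

    proper-dart : ∀ d → ψ (tailD {G} d) ≢ ψ (headD {G} d)
    proper-dart (e , true)  = proper e
    proper-dart (e , false) = proper e ∘ sym

    δ-oriented : ∀ e b → δ (e , b) ≡ oriented (δ (e , true)) b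
    δ-oriented e true  = refl
    δ-oriented e false = δc-antisym _ _ (proper e)

    δsum-divisible-by-3 : ∀ W → + 3 ∣ δsum ψ W
    δsum-divisible-by-3 W = subst (+ 3 ∣_) telescope (∑-∣ _ (allFin (len W)) step)
      where
      z : Fin (len W) → ℤ
      z i = + toℕ (ψ (vtx W i))
      step : ∀ i → + 3 ∣ δ (dart W i) - (z (nextF i) - z i)
      step i = subst (λ v → + 3 ∣ δ (dart W i) - (+ toℕ (ψ v) - z i)) (glued W i)
                     (δc≡difference-mod-3 _ _ (proper-dart (dart W i)))
      telescope : ∑[ i ∈ allFin (len W) ] (δ (dart W i) - (z (nextF i) - z i)) ≡ δsum ψ W
      telescope = trans (∑-distrib-- (δ ∘ dart W) (λ i → z (nextF i) - z i) (allFin (len W)))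
                        (trans (cong (_-_ (δsum ψ W)) (∑-allFin-telescope (lenP W) z)) (+-identityʳ (δsum ψ W)))

    ω*3≡δsum : ∀ W → ω ψ W * + 3 ≡ δsum ψ W
    ω*3≡δsum W = [i/ℕn]*n≡i (δsum ψ W) 3 (δsum-divisible-by-3 W)

    δsum-length-4 : ∀ W → len W ≡ 4 → δsum ψ W ≡ 0ℤ
    δsum-length-4 W@record { dart = d } refl =
      units-sum4-divisible-by-3 (δ-unit (d zero)) (δ-unit (d (suc zero))) (δ-unit (d (suc (suc zero))))
        (δ-unit (d (suc (suc (suc zero))))) (δsum-divisible-by-3 W)

-- Traversals of edges by the cycles of 𝒞

module _ {G : Graph} {k : ℕ} (Q : QuadData G k) where

  edgeAt : (c : CIdx Q) → Fin (len (cyc Q c)) → Fin (nE G)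
  edgeAt c i = edgeOf {G} (dart (cyc Q c) i)

  dirAt : (c : CIdx Q) → Fin (len (cyc Q c)) → Bool
  dirAt c i = proj₂ (dart (cyc Q c) i)

  ∑-dirs : ∀ (v : Bool → ℤ) e →
    ∑ v (dirs Q e) ≡ ∑[ c ∈ allC Q ] ∑[ i ∈ allFin (len (cyc Q c)) ] (if does (edgeAt c i ≟ e) then v (dirAt c i) else 0ℤ)
  ∑-dirs v e = trans (∑-concatMap v dirsOn (allC Q)) (∑-cong ∑-dirsOn (allC Q))
    where
    singletonIf : (c : CIdx Q) → Fin (len (cyc Q c)) → List Bool
    singletonIf c i = if does (edgeAt c i ≟ e) then dirAt c i ∷ [] else []
    dirsOn : CIdx Q → List Bool
    dirsOn c = concatMap (singletonIf c) (allFin (len (cyc Q c)))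
    ∑-dirsOn : ∀ c → ∑ v (dirsOn c) ≡ ∑[ i ∈ allFin (len (cyc Q c)) ] (if does (edgeAt c i ≟ e) then v (dirAt c i) else 0ℤ)
    ∑-dirsOn c = trans (∑-concatMap v (singletonIf c) (allFin (len (cyc Q c))))
                       (∑-cong (λ i → ∑-if-singleton v (does (edgeAt c i ≟ e)) (dirAt c i)) (allFin (len (cyc Q c))))

  ∑-edges-dirs : ∀ (val : Fin (nE G) → Bool → ℤ) →
    ∑[ e ∈ allFin (nE G) ] ∑ (val e) (dirs Q e) ≡ ∑[ c ∈ allC Q ] ∑[ i ∈ allFin (len (cyc Q c)) ] val (edgeAt c i) (dirAt c i)
  ∑-edges-dirs val = begin
    ∑[ e ∈ allFin (nE G) ] ∑ (val e) (dirs Q e)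
      ≡⟨ ∑-cong (λ e → ∑-dirs (val e) e) (allFin (nE G)) ⟩
    ∑[ e ∈ allFin (nE G) ] ∑[ c ∈ allC Q ] ∑[ i ∈ allFin (len (cyc Q c)) ] term c i e
      ≡⟨ ∑-comm (λ e c → ∑[ i ∈ allFin (len (cyc Q c)) ] term c i e) (allFin (nE G)) (allC Q) ⟩
    ∑[ c ∈ allC Q ] ∑[ e ∈ allFin (nE G) ] ∑[ i ∈ allFin (len (cyc Q c)) ] term c i e
      ≡⟨ ∑-cong (λ c → ∑-comm (λ e i → term c i e) (allFin (nE G)) (allFin (len (cyc Q c)))) (allC Q) ⟩
    ∑[ c ∈ allC Q ] ∑[ i ∈ allFin (len (cyc Q c)) ] ∑[ e ∈ allFin (nE G) ] term c i e
      ≡⟨ ∑-cong (λ c → ∑-cong (λ i → ∑-allFin-select (nE G) (edgeAt c i) (λ e → val e (dirAt c i)))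
                                (allFin (len (cyc Q c)))) (allC Q) ⟩
    ∑[ c ∈ allC Q ] ∑[ i ∈ allFin (len (cyc Q c)) ] val (edgeAt c i) (dirAt c i)
      ∎
    where
    open ≡-Reasoning
    term : (c : CIdx Q) → Fin (len (cyc Q c)) → Fin (nE G) → ℤ
    term c i e = if does (edgeAt c i ≟ e) then val e (dirAt c i) else 0ℤ

  ∑-allC : ∀ (g : CIdx Q → ℤ) → ∑ g (allC Q) ≡ ∑ (g ∘ inj₁) (allFin (f Q)) + ∑ (g ∘ inj₂) (allFin k)
  ∑-allC g = trans (∑-++ g (map inj₁ (allFin (f Q))) (map inj₂ (allFin k)))
                   (cong₂ _+_ (∑-map g inj₁ (allFin (f Q))) (∑-map g inj₂ (allFin k)))

  _≟C_ : DecidableEquality (CIdx Q)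
  _≟C_ = ≡-dec _≟_ _≟_

  ∑-allC-select : ∀ c → ∑[ c′ ∈ allC Q ] 𝟙 (c ≟C c′) ≡ 1ℤ
  ∑-allC-select (inj₁ a) =
    trans (∑-allC (𝟙 ∘ (inj₁ a ≟C_))) (cong₂ _+_ (∑-allFin-select (f Q) a (const 1ℤ)) (∑-zero (allFin k)))
  ∑-allC-select (inj₂ a) =
    trans (∑-allC (𝟙 ∘ (inj₂ a ≟C_))) (cong₂ _+_ (∑-zero (allFin (f Q))) (∑-allFin-select k a (const 1ℤ)))

  module _ (quad : IsQuadrangulation Q) where
    open IsQuadrangulation quad

    edgeAt-injective : ∀ c → Injective _≡_ _≡_ (edgeAt c)
    edgeAt-injective (inj₁ i) = proj₂ (proj₁ (faceCycle i))
    edgeAt-injective (inj₂ j) = proj₂ (bdryCycle j)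

    length-dirs : ∀ e → length (dirs Q e) ≡ 2
    length-dirs e with edgeTwice e
    ... | c₁ , c₂ , c₁≢c₂ , on₁ , on₂ , only = +-injective (begin
      + length (dirs Q e)                                        ≡⟨ +length≡∑1 (dirs Q e) ⟩
      ∑ (const 1ℤ) (dirs Q e)                                    ≡⟨ ∑-dirs (const 1ℤ) e ⟩
      ∑[ c ∈ allC Q ] ∑[ i ∈ allFin (len (cyc Q c)) ] 𝟙 (edgeAt c i ≟ e)
                                                                 ≡⟨ ∑-cong occurrences (allC Q) ⟩
      ∑[ c ∈ allC Q ] (𝟙 (c₁ ≟C c) + 𝟙 (c₂ ≟C c))                ≡⟨ ∑-distrib-+ (𝟙 ∘ (c₁ ≟C_)) (𝟙 ∘ (c₂ ≟C_)) (allC Q) ⟩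
      ∑[ c ∈ allC Q ] 𝟙 (c₁ ≟C c) + ∑[ c ∈ allC Q ] 𝟙 (c₂ ≟C c) ≡⟨ cong₂ _+_ (∑-allC-select c₁) (∑-allC-select c₂) ⟩
      + 2                                                        ∎)
      where
      open ≡-Reasoning
      occurrences : ∀ c → ∑[ i ∈ allFin (len (cyc Q c)) ] 𝟙 (edgeAt c i ≟ e) ≡ 𝟙 (c₁ ≟C c) + 𝟙 (c₂ ≟C c)
      occurrences c with any? (λ i → edgeAt c i ≟ e)
      ... | yes (i₀ , on) with only c (i₀ , on)
      ...   | inj₁ refl = trans (∑-allFin-fibre-injective (edgeAt c) (edgeAt-injective c) i₀ on)
                                (sym (cong₂ _+_ (𝟙-yes (c ≟C c) refl) (𝟙-no (c₂ ≟C c) (c₁≢c₂ ∘ sym))))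
      ...   | inj₂ refl = trans (∑-allFin-fibre-injective (edgeAt c) (edgeAt-injective c) i₀ on)
                                (sym (cong₂ _+_ (𝟙-no (c₁ ≟C c) c₁≢c₂) (𝟙-yes (c ≟C c) refl)))
      occurrences c | no off =
        trans (∑-allFin-fibre-empty (edgeAt c) (λ i on → off (i , on)))
              (sym (cong₂ _+_ (𝟙-no (c₁ ≟C c) (λ { refl → off on₁ })) (𝟙-no (c₂ ≟C c) (λ { refl → off on₂ }))))

module _ {G : Graph} {k : ℕ} (Q : QuadData G k) (quad : IsQuadrangulation Q)
         (ψ : Fin (nV G) → Fin 3) (proper : IsColoring G ψ) where
  open IsQuadrangulation quad
  open Colouring G ψ

  twiceInD : Fin (nE G) → ℤ
  twiceInD e = if inD Q e then + 2 else 0ℤ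

  edge-contribution-mod-4 : ∀ e → + 4 ∣ ∑[ b ∈ dirs Q e ] δ (e , b) - twiceInD e
  edge-contribution-mod-4 e with dirs Q e | length-dirs Q quad e
  ... | b₁ ∷ b₂ ∷ [] | refl =
    subst (λ s → + 4 ∣ s - (if does (b₁ ≟ᵇ b₂) then + 2 else 0ℤ))
          (cong₂ (λ x y → x + (y + 0ℤ)) (sym (δ-oriented proper e b₁)) (sym (δ-oriented proper e b₂)))
          (unit-twice-oriented-mod-4 (δ-unit (e , true)) b₁ b₂)

  ∑-cycles≡∑-boundaries : ∑[ c ∈ allC Q ] δsum ψ (cyc Q c) ≡ ∑[ j ∈ allFin k ] δsum ψ (bdry Q j)
  ∑-cycles≡∑-boundaries =
    trans (∑-allC Q (δsum ψ ∘ cyc Q)) (trans (cong (_+ ∑[ j ∈ allFin k ] δsum ψ (bdry Q j)) faces-vanish) (+-identityˡ _))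
    where
    faces-vanish : ∑[ i ∈ allFin (f Q) ] δsum ψ (face Q i) ≡ 0ℤ
    faces-vanish = trans (∑-cong (λ i → δsum-length-4 proper (face Q i) (proj₂ (faceCycle i))) (allFin (f Q)))
                         (∑-zero (allFin (f Q)))

  ∑-boundaries≡2|D|-mod-4 : + 4 ∣ ∑[ j ∈ allFin k ] δsum ψ (bdry Q j) - + (2 ℕ.* sizeD Q)
  ∑-boundaries≡2|D|-mod-4 = subst (+ 4 ∣_) regroup (∑-∣ _ (allFin (nE G)) edge-contribution-mod-4)
    where
    regroup : ∑[ e ∈ allFin (nE G) ] (∑[ b ∈ dirs Q e ] δ (e , b) - twiceInD e)
            ≡ ∑[ j ∈ allFin k ] δsum ψ (bdry Q j) - + (2 ℕ.* sizeD Q)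
    regroup = begin
      ∑[ e ∈ allFin (nE G) ] (∑[ b ∈ dirs Q e ] δ (e , b) - twiceInD e)
        ≡⟨ ∑-distrib-- (λ e → ∑[ b ∈ dirs Q e ] δ (e , b)) twiceInD (allFin (nE G)) ⟩
      ∑[ e ∈ allFin (nE G) ] ∑[ b ∈ dirs Q e ] δ (e , b) - ∑ twiceInD (allFin (nE G))
        ≡⟨ cong₂ _-_ (∑-edges-dirs Q (λ e b → δ (e , b))) (∑-if-count (inD Q) 2 (allFin (nE G))) ⟩
      ∑[ c ∈ allC Q ] δsum ψ (cyc Q c) - + (2 ℕ.* sizeD Q)
        ≡⟨ cong (_- + (2 ℕ.* sizeD Q)) ∑-cycles≡∑-boundaries ⟩
      ∑[ j ∈ allFin k ] δsum ψ (bdry Q j) - + (2 ℕ.* sizeD Q)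
        ∎
      where open ≡-Reasoning

  ∑-boundaries≡∑ω*3 : ∑[ j ∈ allFin k ] δsum ψ (bdry Q j) ≡ ∑[ j ∈ allFin k ] ω ψ (bdry Q j) * + 3
  ∑-boundaries≡∑ω*3 = trans (∑-cong (λ j → sym (ω*3≡δsum proper (bdry Q j))) (allFin k))
                            (∑-distribʳ-* (λ j → ω ψ (bdry Q j)) (+ 3) (allFin k))

  ∑ω*3≡2|D|-mod-4 : + 4 ∣ ∑[ j ∈ allFin k ] ω ψ (bdry Q j) * + 3 - + (2 ℕ.* sizeD Q)
  ∑ω*3≡2|D|-mod-4 = subst (λ s → + 4 ∣ s - + (2 ℕ.* sizeD Q)) ∑-boundaries≡∑ω*3 ∑-boundaries≡2|D|-mod-4

mainTheorem6 : (G : Graph) (k : ℕ) (Q : QuadData G k) → IsQuadrangulation Q →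
    (ψ : Fin (nV G) → Fin 3) → IsColoring G ψ →
    sumℤ (map (λ i → ω ψ (bdry Q i)) (allFin k)) ≡ + (parity Q) [mod 4 ]
mainTheorem6 G k Q quad ψ proper =
  ∣⇒∣ᵤ (w*3≡2s⇒w≡2s%4 (∑[ j ∈ allFin k ] ω ψ (bdry Q j)) (sizeD Q) (∑ω*3≡2|D|-mod-4 Q quad ψ proper))
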